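{- Let $A(p)$ be an $\mathcal{L}'$-formula modalized in $p$ in which no free variable also occurs as a bound variable, and let $(A_n)_{n<\omega}$ be defined from $A(p)$ as below. For any $\mathcal{L}'$-formula $B(p)$ and any $m,n\in\mathbb{N}$ with $m\geq n$, $$\mathbf{QK}\vdash\Box^{n+1}\bot\to\big(B^n\leftrightarrow B(A_m)\big),$$ where $B^n:\equiv B^{\top(n)}(p)[A_n,\ldots,A_0]$.
   Context: Language $\mathcal{L}$: individual variables, $\top,\bot$, $\neg,\to$, $\forall$, $\Box$, predicate symbols; formulas built from $\top,\bot,P(u_1,\ldots,u_n)$ by $\neg,\to,\forall u,\Box$. $\mathcal{L}'$ is $\mathcal{L}$ plus one fixed propositional variable $p$; $B(F)$ denotes replacing every occurrence of $p$ in $B(p)$ by $F$. $A(p)$ is modalized in $p$ if every occurrence of $p$ is in the scope of a $\Box$. $\Box^k A$ is $A$ prefixed by $k$ boxes. The depth of an occurrence of a subformula $C$ in $B$ is the number of subformulas of $B$ of the form $\Box D$ containing that occurrence, other than $C$ itself. $B^{\top(n)}$ is obtained from $B$ by replacing every occurrence of a subformula $\Box C$ of depth $n$ by $\top$. $B(p)[C_0,\ldots,C_n]$ is obtained by substituting $C_i$ for all occurrences of $p$ of depth $i$, for each $i\leq n$ (so in $B^{\top(n)}(p)[A_n,\ldots,A_0]$, $A_{n-j}$ replaces the occurrences of $p$ of depth $j$). The sequence: $A_0:\equiv A^{\top(0)}(p)[\top]$ and $A_{n+1}:\equiv A^{\top(n+1)}(p)[\top,A_n,\ldots,A_0]$.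 $\mathbf{QK}$: all instances of the axioms of classical first-order predicate logic and $\Box(A\to B)\to(\Box A\to\Box B)$, with rules modus ponens, generalization and necessitation. -}

module Defs where

open import Data.Nat using (ℕ; zero; suc; _≡ᵇ_)
open import Data.Bool using (Bool; true; false; not; _∧_; _∨_; if_then_else_)
open import Data.List using (List; []; _∷_)
open import Data.Bool.ListAction using (any)
open import Relation.Binary.PropositionalEquality using (_≡_)
open import Data.Empty using (⊥)
open import Data.Unit using (⊤)
open import Data.Product using (_×_)

Var : Set
Var = ℕ

-- Formulas of L' (L plus the single propositional variable p).
-- L-formulas are exactly those not containing `pv`.
data Fm : Set where
  ⊤' ⊥' : Fm
  pv    : Fm
  Pr    : ℕ → List Var → Fm
  ¬'_   : Fm → Fm
  _⇒_   : Fm → Fm → Fm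
  ∀'    : Var → Fm → Fm
  □     : Fm → Fm

infixr 5 _⇒_
infix 6 ¬'_

_∧'_ : Fm → Fm → Fm
A ∧' B = ¬' (A ⇒ ¬' B)

_⇔_ : Fm → Fm → Fm
A ⇔ B = (A ⇒ B) ∧' (B ⇒ A)

□^ : ℕ → Fm → Fm
□^ zero A = A
□^ (suc k) A = □ (□^ k A)

freeIn : Var → Fm → Bool
freeIn x ⊤' = false
freeIn x ⊥' = false
freeIn x pv = false
freeIn x (Pr _ us) = any (λ u → u ≡ᵇ x) us
freeIn x (¬' A) = freeIn x A
freeIn x (A ⇒ B) = freeIn x A ∨ freeIn x B
freeIn x (∀' u A) = not (u ≡ᵇ x) ∧ freeIn x A
freeIn x (□ A) = freeIn x A

boundIn : Var → Fm → Bool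
boundIn x ⊤' = false
boundIn x ⊥' = false
boundIn x pv = false
boundIn x (Pr _ _) = false
boundIn x (¬' A) = boundIn x A
boundIn x (A ⇒ B) = boundIn x A ∨ boundIn x B
boundIn x (∀' u A) = (u ≡ᵇ x) ∨ boundIn x A
boundIn x (□ A) = boundIn x A

NoFreeBoundClash : Fm → Set
NoFreeBoundClash A = ∀ x → freeIn x A ≡ true → boundIn x A ≡ false

substV : Var → Var → Fm → Fm
substV x y ⊤' = ⊤'
substV x y ⊥' = ⊥'
substV x y pv = pv
substV x y (Pr P us) = Pr P (Data.List.map (λ u → if u ≡ᵇ x then y else u) us)
substV x y (¬' A) = ¬' substV x y A
substV x y (A ⇒ B) = substV x y A ⇒ substV x y B
substV x y (∀' u A) = if u ≡ᵇ x then ∀' u A else ∀' u (substV x y A)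
substV x y (□ A) = □ (substV x y A)

freeFor : Var → Var → Fm → Bool
freeFor y x ⊤' = true
freeFor y x ⊥' = true
freeFor y x pv = true
freeFor y x (Pr _ _) = true
freeFor y x (¬' A) = freeFor y x A
freeFor y x (A ⇒ B) = freeFor y x A ∧ freeFor y x B
freeFor y x (∀' u A) =
  (u ≡ᵇ x) ∨ (not (freeIn x A) ∨ (not (u ≡ᵇ y) ∧ freeFor y x A))
freeFor y x (□ A) = freeFor y x A

-- Classical propositional tautologies (instances): formulas whose
-- principal structure in ⊤,⊥,¬,→ is true under every assignment of truth
-- values to the remaining (prime) subformulas.

evalP : (Fm → Bool) → Fm → Bool
evalP v ⊤' = true
evalP v ⊥' = false
evalP v (¬' A) = not (evalP v A)
evalP v (A ⇒ B) = not (evalP v A) ∨ evalP v B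
evalP v A = v A

Tautology : Fm → Set
Tautology A = ∀ (v : Fm → Bool) → evalP v A ≡ true

data QK⊢_ : Fm → Set where
  taut : ∀ {A} → Tautology A → QK⊢ A
  ax∀E : ∀ {A x y} → freeFor y x A ≡ true → QK⊢ (∀' x A ⇒ substV x y A)
  ax∀I : ∀ {A B x} → freeIn x A ≡ false → QK⊢ (∀' x (A ⇒ B) ⇒ (A ⇒ ∀' x B))
  axK  : ∀ {A B} → QK⊢ (□ (A ⇒ B) ⇒ (□ A ⇒ □ B))
  mp   : ∀ {A B} → QK⊢ (A ⇒ B) → QK⊢ A → QK⊢ B
  gen  : ∀ {A} x → QK⊢ A → QK⊢ ∀' x A
  nec  : ∀ {A} → QK⊢ A → QK⊢ □ A

infix 2 QK⊢_

Modalized : Fm → Set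
Modalized ⊤' = ⊤
Modalized ⊥' = ⊤
Modalized pv = ⊥
Modalized (Pr _ _) = ⊤
Modalized (¬' A) = Modalized A
Modalized (A ⇒ B) = Modalized A × Modalized B
Modalized (∀' _ A) = Modalized A
Modalized (□ _) = ⊤

-- B(F): replace every occurrence of p by F (textual replacement)

subAll : Fm → Fm → Fm
subAll F ⊤' = ⊤'
subAll F ⊥' = ⊥'
subAll F pv = F
subAll F (Pr P us) = Pr P us
subAll F (¬' A) = ¬' subAll F A
subAll F (A ⇒ B) = subAll F A ⇒ subAll F B
subAll F (∀' u A) = ∀' u (subAll F A)
subAll F (□ A) = □ (subAll F A)

-- B^{⊤(n)}: replace every occurrence of a subformula □C of depth n by ⊤
topAt : ℕ → Fm → Fm
topAt n ⊤' = ⊤'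
topAt n ⊥' = ⊥'
topAt n pv = pv
topAt n (Pr P us) = Pr P us
topAt n (¬' A) = ¬' topAt n A
topAt n (A ⇒ B) = topAt n A ⇒ topAt n B
topAt n (∀' u A) = ∀' u (topAt n A)
topAt zero (□ A) = ⊤'
topAt (suc n) (□ A) = □ (topAt n A)

-- B(p)[C0,...,Cn]: substitute C_i for the occurrences of p of depth i
-- (occurrences of p of depth > n are left unchanged)
subD : List Fm → Fm → Fm
subD Cs ⊤' = ⊤'
subD Cs ⊥' = ⊥'
subD [] pv = pv
subD (C ∷ Cs) pv = C
subD Cs (Pr P us) = Pr P us
subD Cs (¬' A) = ¬' subD Cs A
subD Cs (A ⇒ B) = subD Cs A ⇒ subD Cs B
subD Cs (∀' u A) = ∀' u (subD Cs A)
subD [] (□ A) = □ A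
subD (C ∷ Cs) (□ A) = □ (subD Cs A)

-- The sequence (A_n): seqA A n = [A_n, A_{n-1}, ..., A_0]
--   A_0     = A^{⊤(0)}(p)[⊤]
--   A_{n+1} = A^{⊤(n+1)}(p)[⊤, A_n, ..., A_0]

seqA : Fm → ℕ → List Fm
seqA A zero = subD (⊤' ∷ []) (topAt zero A) ∷ []
seqA A (suc n) = subD (⊤' ∷ seqA A n) (topAt (suc n) A) ∷ seqA A n

headF : List Fm → Fm
headF [] = ⊤'
headF (C ∷ _) = C

An : Fm → ℕ → Fm
An A n = headF (seqA A n)

Bn : Fm → Fm → ℕ → Fm
Bn A B n = subD (seqA A n) (topAt n B)

module Submission where

-- Write Bound k for □^{k+1}⊥ and H ⊢ X for QK ⊢ H → X.  Both B^n and B(A_m)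
-- are instances of depth-indexed substitution subDepth σ, which puts σ i for
-- the occurrences of p of depth i.  Two general facts carry the argument:
--   * truncation: Bound k ⊢ subDepth σ (B^{⊤(k)}) ↔ subDepth σ B, since under
--     □^{k+1}⊥ every boxed formula of depth k is provable, hence ↔ ⊤;
--   * congruence: if σ i ↔ τ i under Bound (k ∸ i) for all i ≤ k, then
--     subDepth σ (B^{⊤(k)}) ↔ subDepth τ (B^{⊤(k)}) under Bound k.
-- By strong induction on j these give stabilisation of the sequence:
-- Bound j ⊢ A_j ↔ A_m for m ≥ j.  The theorem is then one congruence step
-- (B^n against B^{⊤(n)}(A_m)) and one truncation step.

open import Defs
open import Data.Nat using (ℕ; zero; suc; _≤_; _<_; _≡ᵇ_; z≤n; s≤s)
open import Data.Nat.Properties using (≡ᵇ⇒≡; ≡⇒≡ᵇ; ≤-refl; ≤-trans; n≤1+n; m≤n⇒m≤1+n)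
open import Data.Nat.Induction using (<-rec)
open import Data.Bool using (Bool; true; false; not; _∧_; _∨_; if_then_else_)
open import Data.Bool.Properties using (T-≡; ∨-zeroʳ)
open import Data.List using (List; []; _∷_; map)
open import Data.Product using (_×_; _,_; proj₁)
open import Function using (_∘_)
open import Function.Bundles using (Equivalence)
open import Relation.Binary.PropositionalEquality
  using (_≡_; refl; cong; cong₂; subst; subst₂; sym)

_⊢_ : Fm → Fm → Set
H ⊢ X = QK⊢ H ⇒ X

infix 2 _⊢_

Bound : ℕ → Fm
Bound k = □^ (suc k) ⊥'

_→ᵇ_ : Bool → Bool → Bool
a →ᵇ b = not a ∨ b

_∧ᵇ_ : Bool → Bool → Bool
a ∧ᵇ b = not (a →ᵇ not b)

_↔ᵇ_ : Bool → Bool → Bool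
a ↔ᵇ b = (a →ᵇ b) ∧ᵇ (b →ᵇ a)

infixr 5 _→ᵇ_
infix 6 _↔ᵇ_

BoolFn : ℕ → Set
BoolFn zero = Bool
BoolFn (suc n) = Bool → BoolFn n

AllTrue : (n : ℕ) → BoolFn n → Set
AllTrue zero b = b ≡ true
AllTrue (suc n) f = ∀ a → AllTrue n (f a)

valid : (n : ℕ) → BoolFn n → Bool
valid zero b = b
valid (suc n) f = valid n (f true) ∧ valid n (f false)

valid-sound : ∀ n (f : BoolFn n) → valid n f ≡ true → AllTrue n f
valid-sound zero b ok = ok
valid-sound (suc n) f ok true = valid-sound n (f true) (∧-left ok)
  where
  ∧-left : ∀ {a b} → a ∧ b ≡ true → a ≡ true
  ∧-left {true} ok = refl
valid-sound (suc n) f ok false = valid-sound n (f false) (∧-right ok)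
  where
  ∧-right : ∀ {a b} → a ∧ b ≡ true → b ≡ true
  ∧-right {true} ok = ok

-- Propositional rules for H ⊢ X
-- Each rule is a single instance of a tautology, checked by valid-sound on
-- the truth values of its prime subformulas.

⊢-trans : ∀ {H P Q} → H ⊢ P → P ⊢ Q → H ⊢ Q
⊢-trans {H} {P} {Q} = mp ∘ mp (taut λ v → valid-sound 3
  (λ h p q → (h →ᵇ p) →ᵇ (p →ᵇ q) →ᵇ (h →ᵇ q)) refl
  (evalP v H) (evalP v P) (evalP v Q))

strengthen : ∀ {H G X Y} → H ⊢ X ⇒ Y → G ⊢ X → H ⊢ G ⇒ Y
strengthen {H} {G} {X} {Y} = mp ∘ mp (taut λ v → valid-sound 4
  (λ h g x y → (h →ᵇ x →ᵇ y) →ᵇ (g →ᵇ x) →ᵇ (h →ᵇ g →ᵇ y)) refl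
  (evalP v H) (evalP v G) (evalP v X) (evalP v Y))

ex-falso : ∀ {Y} → ⊥' ⊢ Y
ex-falso = taut λ v → refl

⇔-refl : ∀ {H X} → H ⊢ X ⇔ X
⇔-refl {H} {X} = taut λ v → valid-sound 2
  (λ h x → h →ᵇ (x ↔ᵇ x)) refl (evalP v H) (evalP v X)

⇔-intro : ∀ {H X Y} → H ⊢ X ⇒ Y → H ⊢ Y ⇒ X → H ⊢ X ⇔ Y
⇔-intro {H} {X} {Y} = mp ∘ mp (taut λ v → valid-sound 3
  (λ h x y → (h →ᵇ x →ᵇ y) →ᵇ (h →ᵇ y →ᵇ x) →ᵇ (h →ᵇ (x ↔ᵇ y))) refl
  (evalP v H) (evalP v X) (evalP v Y))

⇔-elimˡ : ∀ {H X Y} → H ⊢ X ⇔ Y → H ⊢ X ⇒ Y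
⇔-elimˡ {H} {X} {Y} = mp (taut λ v → valid-sound 3
  (λ h x y → (h →ᵇ (x ↔ᵇ y)) →ᵇ (h →ᵇ x →ᵇ y)) refl
  (evalP v H) (evalP v X) (evalP v Y))

⇔-elimʳ : ∀ {H X Y} → H ⊢ X ⇔ Y → H ⊢ Y ⇒ X
⇔-elimʳ {H} {X} {Y} = mp (taut λ v → valid-sound 3
  (λ h x y → (h →ᵇ (x ↔ᵇ y)) →ᵇ (h →ᵇ y →ᵇ x)) refl
  (evalP v H) (evalP v X) (evalP v Y))

⇔-sym : ∀ {H X Y} → H ⊢ X ⇔ Y → H ⊢ Y ⇔ X
⇔-sym p = ⇔-intro (⇔-elimʳ p) (⇔-elimˡ p)

⇔-trans : ∀ {H X Y Z} → H ⊢ X ⇔ Y → H ⊢ Y ⇔ Z → H ⊢ X ⇔ Z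
⇔-trans {H} {X} {Y} {Z} = mp ∘ mp (taut λ v → valid-sound 4
  (λ h x y z → (h →ᵇ (x ↔ᵇ y)) →ᵇ (h →ᵇ (y ↔ᵇ z)) →ᵇ (h →ᵇ (x ↔ᵇ z))) refl
  (evalP v H) (evalP v X) (evalP v Y) (evalP v Z))

⊤-intro : ∀ {H Y} → H ⊢ Y → H ⊢ ⊤' ⇔ Y
⊤-intro {H} {Y} = mp (taut λ v → valid-sound 2
  (λ h y → (h →ᵇ y) →ᵇ (h →ᵇ (true ↔ᵇ y))) refl (evalP v H) (evalP v Y))

¬-cong : ∀ {H X Y} → H ⊢ X ⇔ Y → H ⊢ (¬' X) ⇔ (¬' Y)
¬-cong {H} {X} {Y} = mp (taut λ v → valid-sound 3
  (λ h x y → (h →ᵇ (x ↔ᵇ y)) →ᵇ (h →ᵇ (not x ↔ᵇ not y))) refl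
  (evalP v H) (evalP v X) (evalP v Y))

⇒-cong : ∀ {H X Y X' Y'} → H ⊢ X ⇔ Y → H ⊢ X' ⇔ Y' →
  H ⊢ (X ⇒ X') ⇔ (Y ⇒ Y')
⇒-cong {H} {X} {Y} {X'} {Y'} = mp ∘ mp (taut λ v → valid-sound 5
  (λ h x y x' y' → (h →ᵇ (x ↔ᵇ y)) →ᵇ (h →ᵇ (x' ↔ᵇ y')) →ᵇ
                   (h →ᵇ ((x →ᵇ x') ↔ᵇ (y →ᵇ y')))) refl
  (evalP v H) (evalP v X) (evalP v Y) (evalP v X') (evalP v Y'))

⇔-lift : ∀ {H H' X Y} (f : Fm → Fm) →
  (∀ {X Y} → H ⊢ X ⇒ Y → H' ⊢ f X ⇒ f Y) → H ⊢ X ⇔ Y → H' ⊢ f X ⇔ f Y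
⇔-lift f mono p = ⇔-intro (mono (⇔-elimˡ p)) (mono (⇔-elimʳ p))

box-mono : ∀ {X Y} → X ⊢ Y → □ X ⊢ □ Y
box-mono p = mp axK (nec p)

box-cong : ∀ {H X Y} → H ⊢ X ⇔ Y → □ H ⊢ □ X ⇔ □ Y
box-cong = ⇔-lift □ (λ p → ⊢-trans (box-mono p) axK)

-- Under □⊥ every boxed formula holds, so it is equivalent to ⊤.
box-trivial : ∀ {Y} → □ ⊥' ⊢ ⊤' ⇔ □ Y
box-trivial = ⊤-intro (box-mono ex-falso)

bound-mono : ∀ {k m} → k ≤ m → Bound k ⊢ Bound m
bound-mono z≤n = box-mono ex-falso
bound-mono (s≤s k≤m) = box-mono (bound-mono k≤m)

≡ᵇ-refl : ∀ u → (u ≡ᵇ u) ≡ true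
≡ᵇ-refl u = Equivalence.to T-≡ (≡⇒≡ᵇ u u refl)

-- Substituting a variable for itself changes nothing and is always allowed;
-- this gives the instantiation axiom ∀u X → X.
substV-self : ∀ u X → substV u u X ≡ X
substV-self u ⊤' = refl
substV-self u ⊥' = refl
substV-self u pv = refl
substV-self u (Pr P us) = cong (Pr P) (map-self us)
  where
  rename : ℕ → ℕ
  rename w = if w ≡ᵇ u then u else w
  rename-self : ∀ w → rename w ≡ w
  rename-self w with w ≡ᵇ u in eq
  ... | true = sym (≡ᵇ⇒≡ w u (Equivalence.from T-≡ eq))
  ... | false = refl
  map-self : ∀ us → map rename us ≡ us
  map-self [] = refl
  map-self (w ∷ us) = cong₂ _∷_ (rename-self w) (map-self us)
substV-self u (¬' X) = cong ¬'_ (substV-self u X)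
substV-self u (X ⇒ Y) = cong₂ _⇒_ (substV-self u X) (substV-self u Y)
substV-self u (∀' w X) with w ≡ᵇ u
... | true = refl
... | false = cong (∀' w) (substV-self u X)
substV-self u (□ X) = cong □ (substV-self u X)

freeFor-self : ∀ u X → freeFor u u X ≡ true
freeFor-self u ⊤' = refl
freeFor-self u ⊥' = refl
freeFor-self u pv = refl
freeFor-self u (Pr _ _) = refl
freeFor-self u (¬' X) = freeFor-self u X
freeFor-self u (X ⇒ Y) rewrite freeFor-self u X | freeFor-self u Y = refl
freeFor-self u (∀' w X) with w ≡ᵇ u
... | true = refl
... | false rewrite freeFor-self u X = ∨-zeroʳ (not (freeIn u X))
freeFor-self u (□ X) = freeFor-self u X

instantiate : ∀ u X → ∀' u X ⊢ X
instantiate u X = subst (λ Z → ∀' u X ⊢ Z) (substV-self u X)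
  (ax∀E (freeFor-self u X))

-- The rule H ⊢ X ⇒ Y / H ⊢ ∀u X ⇒ ∀u Y, when u is not free in H:
-- H ⊢ ∀u X ⇒ Y, generalise and distribute ∀u twice.
all-mono : ∀ {H X Y} u → freeIn u H ≡ false →
  H ⊢ X ⇒ Y → H ⊢ ∀' u X ⇒ ∀' u Y
all-mono {X = X} u u∉H p =
  ⊢-trans (mp (ax∀I u∉H) (gen u (strengthen p (instantiate u X))))
          (ax∀I u∉∀uX)
  where
  u∉∀uX : freeIn u (∀' u X) ≡ false
  u∉∀uX rewrite ≡ᵇ-refl u = refl

all-cong : ∀ {H X Y} u → freeIn u H ≡ false →
  H ⊢ X ⇔ Y → H ⊢ ∀' u X ⇔ ∀' u Y
all-cong u u∉H = ⇔-lift (∀' u) (all-mono u u∉H)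

free-Bound : ∀ u k → freeIn u (Bound k) ≡ false
free-Bound u zero = refl
free-Bound u (suc k) = free-Bound u k

subDepth : (ℕ → Fm) → Fm → Fm
subDepth σ ⊤' = ⊤'
subDepth σ ⊥' = ⊥'
subDepth σ pv = σ 0
subDepth σ (Pr P us) = Pr P us
subDepth σ (¬' X) = ¬' subDepth σ X
subDepth σ (X ⇒ Y) = subDepth σ X ⇒ subDepth σ Y
subDepth σ (∀' u X) = ∀' u (subDepth σ X)
subDepth σ (□ X) = □ (subDepth (σ ∘ suc) X)

-- The substitution given by a list [C₀, …, Cₙ]: Cᵢ at depth i ≤ n, and p
-- itself at greater depths.
entry : List Fm → ℕ → Fm
entry [] i = pv
entry (C ∷ Cs) zero = C
entry (C ∷ Cs) (suc i) = entry Cs i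

subDepth-pv : ∀ X → subDepth (λ _ → pv) X ≡ X
subDepth-pv ⊤' = refl
subDepth-pv ⊥' = refl
subDepth-pv pv = refl
subDepth-pv (Pr P us) = refl
subDepth-pv (¬' X) = cong ¬'_ (subDepth-pv X)
subDepth-pv (X ⇒ Y) = cong₂ _⇒_ (subDepth-pv X) (subDepth-pv Y)
subDepth-pv (∀' u X) = cong (∀' u) (subDepth-pv X)
subDepth-pv (□ X) = cong □ (subDepth-pv X)

subD-subDepth : ∀ Cs X → subD Cs X ≡ subDepth (entry Cs) X
subD-subDepth Cs ⊤' = refl
subD-subDepth Cs ⊥' = refl
subD-subDepth [] pv = refl
subD-subDepth (C ∷ Cs) pv = refl
subD-subDepth Cs (Pr P us) = refl
subD-subDepth Cs (¬' X) = cong ¬'_ (subD-subDepth Cs X)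
subD-subDepth Cs (X ⇒ Y) = cong₂ _⇒_ (subD-subDepth Cs X) (subD-subDepth Cs Y)
subD-subDepth Cs (∀' u X) = cong (∀' u) (subD-subDepth Cs X)
subD-subDepth [] (□ X) = sym (cong □ (subDepth-pv X))
subD-subDepth (C ∷ Cs) (□ X) = cong □ (subD-subDepth Cs X)

subAll-subDepth : ∀ F X → subAll F X ≡ subDepth (λ _ → F) X
subAll-subDepth F ⊤' = refl
subAll-subDepth F ⊥' = refl
subAll-subDepth F pv = refl
subAll-subDepth F (Pr P us) = refl
subAll-subDepth F (¬' X) = cong ¬'_ (subAll-subDepth F X)
subAll-subDepth F (X ⇒ Y) = cong₂ _⇒_ (subAll-subDepth F X) (subAll-subDepth F Y)
subAll-subDepth F (∀' u X) = cong (∀' u) (subAll-subDepth F X)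
subAll-subDepth F (□ X) = cong □ (subAll-subDepth F X)

-- Truncation and congruence under Bound k

truncate : ∀ k σ B → Bound k ⊢ subDepth σ (topAt k B) ⇔ subDepth σ B
truncate k σ ⊤' = ⇔-refl
truncate k σ ⊥' = ⇔-refl
truncate k σ pv = ⇔-refl
truncate k σ (Pr P us) = ⇔-refl
truncate k σ (¬' B) = ¬-cong (truncate k σ B)
truncate k σ (B ⇒ B') = ⇒-cong (truncate k σ B) (truncate k σ B')
truncate k σ (∀' u B) = all-cong u (free-Bound u k) (truncate k σ B)
truncate zero σ (□ B) = box-trivial
truncate (suc k) σ (□ B) = box-cong (truncate k (σ ∘ suc) B)

truncate≤ : ∀ {k m} σ B → k ≤ m →
  Bound k ⊢ subDepth σ (topAt m B) ⇔ subDepth σ B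
truncate≤ {m = m} σ B k≤m = ⊢-trans (bound-mono k≤m) (truncate m σ B)

-- Agree k σ τ: σ i and τ i are equivalent under Bound (k ∸ i), i ≤ k.
Agree : ℕ → (ℕ → Fm) → (ℕ → Fm) → Set
Agree zero σ τ = Bound zero ⊢ σ 0 ⇔ τ 0
Agree (suc k) σ τ = (Bound (suc k) ⊢ σ 0 ⇔ τ 0) × Agree k (σ ∘ suc) (τ ∘ suc)

agree-head : ∀ k {σ τ} → Agree k σ τ → Bound k ⊢ σ 0 ⇔ τ 0
agree-head zero σ≈τ = σ≈τ
agree-head (suc k) σ≈τ = proj₁ σ≈τ

congruence : ∀ k {σ τ} B → Agree k σ τ →
  Bound k ⊢ subDepth σ (topAt k B) ⇔ subDepth τ (topAt k B)
congruence k ⊤' σ≈τ = ⇔-refl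
congruence k ⊥' σ≈τ = ⇔-refl
congruence k pv σ≈τ = agree-head k σ≈τ
congruence k (Pr P us) σ≈τ = ⇔-refl
congruence k (¬' B) σ≈τ = ¬-cong (congruence k B σ≈τ)
congruence k (B ⇒ B') σ≈τ = ⇒-cong (congruence k B σ≈τ) (congruence k B' σ≈τ)
congruence k (∀' u B) σ≈τ = all-cong u (free-Bound u k) (congruence k B σ≈τ)
congruence zero (□ B) σ≈τ = ⇔-refl
congruence (suc k) (□ B) (_ , σ≈τ) = box-cong (congruence k B σ≈τ)

-- Stabilisation of the sequence (A_n)

module Stabilisation (A : Fm) where

  -- The terms [A_{j-1}, …, A_0] substituted (below a ⊤) in defining A_j.
  earlier : ℕ → List Fm
  earlier zero = []
  earlier (suc j) = seqA A j

  An-unfold : ∀ j → An A j ≡ subDepth (entry (⊤' ∷ earlier j)) (topAt j A)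
  An-unfold zero = subD-subDepth (⊤' ∷ []) (topAt zero A)
  An-unfold (suc j) = subD-subDepth (⊤' ∷ seqA A j) (topAt (suc j) A)

  Stable : ℕ → Set
  Stable j = ∀ m → j ≤ m → Bound j ⊢ An A j ⇔ An A m

  -- [A_k, …, A_0] agrees with [A_m, …, A_{m-k}, …] up to depth k, since
  -- A_{k-i} ⇔ A_{m-i} under Bound (k ∸ i).
  agree-seqA : ∀ {k m} → k ≤ m → (∀ {i} → i ≤ k → Stable i) →
    Agree k (entry (seqA A k)) (entry (seqA A m))
  agree-seqA {zero} {zero} _ stable = stable z≤n zero z≤n
  agree-seqA {zero} {suc m} _ stable = stable z≤n (suc m) z≤n
  agree-seqA {suc k} {suc m} (s≤s k≤m) stable =
    stable ≤-refl (suc m) (s≤s k≤m) , agree-seqA k≤m (stable ∘ m≤n⇒m≤1+n)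

  agree-earlier : ∀ {j m} → j ≤ m → (∀ {i} → i < j → Stable i) →
    Agree j (entry (⊤' ∷ earlier j)) (entry (⊤' ∷ earlier m))
  agree-earlier {zero} _ _ = ⇔-refl
  agree-earlier {suc j} {suc m} (s≤s j≤m) stable =
    ⇔-refl , agree-seqA j≤m (stable ∘ s≤s)

  -- A_j = A^{⊤(j)}[⊤, A_{j-1}, …] ⇔ A^{⊤(j)}[⊤, A_{m-1}, …]   (congruence)
  --     ⇔ A[⊤, A_{m-1}, …] ⇔ A^{⊤(m)}[⊤, A_{m-1}, …] = A_m    (truncation)
  stable-step : ∀ j → (∀ {i} → i < j → Stable i) → Stable j
  stable-step j stable-below m j≤m =
    subst₂ (λ X Y → Bound j ⊢ X ⇔ Y) (sym (An-unfold j)) (sym (An-unfold m))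
      (⇔-trans (congruence j A (agree-earlier j≤m stable-below))
        (⇔-trans (truncate j σₘ A) (⇔-sym (truncate≤ σₘ A j≤m))))
    where
    σₘ : ℕ → Fm
    σₘ = entry (⊤' ∷ earlier m)

  stable : ∀ j → Stable j
  stable = <-rec Stable stable-step

  agree-limit : ∀ {n m} → n ≤ m → Agree n (entry (seqA A n)) (λ _ → An A m)
  agree-limit {zero} {m} _ = stable zero m z≤n
  agree-limit {suc n} {m} n<m =
    stable (suc n) m n<m , agree-limit (≤-trans (n≤1+n n) n<m)

lemma4p7 : (A : Fm) → Modalized A → NoFreeBoundClash A →
    (B : Fm) (m n : ℕ) → n ≤ m →
    QK⊢ (□^ (suc n) ⊥' ⇒ (Bn A B n ⇔ subAll (An A m) B))
lemma4p7 A _ _ B m n n≤m =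
  subst₂ (λ X Y → Bound n ⊢ X ⇔ Y)
    (sym (subD-subDepth (seqA A n) (topAt n B)))
    (sym (subAll-subDepth (An A m) B))
    (⇔-trans (congruence n B (agree-limit n≤m)) (truncate n (λ _ → An A m) B))
  where open Stabilisation A
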